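{- Each of the graphs $P_4$, $\ltimes$, $\mathsf{dart}$, $K_5\setminus P_3$, $\overline{P_2\cup C_4}$, $K_{2,2,2}$, $K_{2,2,1,1}$ is a minimal forbidden graph for the class of simple connected graphs $G$ with $\gamma_{\mathbb{R}}(G)\le 2$; that is, for each such graph $G$ one has $\gamma_{\mathbb{R}}(G)\geq 3$ while $\gamma_{\mathbb{R}}(G-v)\leq 2$ for every vertex $v$ of $G$.
   Context: For a graph $G$ and indeterminates $X_G=\{x_u : u\in V(G)\}$, the generalized Laplacian matrix $L(G,X_G)$ has $uu$-entry $x_u$ and $uv$-entry $-m_{uv}$ for $u\neq v$, where $m_{uv}$ is the number of edges between $u$ and $v$. The $i$-th critical ideal $I_i^{\mathbb{R}}(G,X_G)\subseteq\mathbb{R}[X_G]$ is generated by all $i\times i$ minors of $L(G,X_G)$; $\gamma_{\mathbb{R}}(G)$ is the largest $i$ with $I_i^{\mathbb{R}}(G,X_G)=\langle 1\rangle$. Graphs: $P_4$ is the path on 4 vertices; $\ltimes$ is a triangle $v_1v_2v_3$ plus two vertices $v_4,v_5$ each adjacent only to $v_3$; $\mathsf{dart}$ has vertices $v_1,\dots,v_5$ and edges $v_1v_2,v_1v_3,v_2v_3,v_2v_4,v_3v_4,v_3v_5$; $K_5\setminus P_3$ is $K_5$ minus the two edges of a path on three vertices; $\overline{P_2\cup C_4}$ is the complement of the disjoint union of an edge and a 4-cycle; $K_{2,2,2}$, $K_{2,2,1,1}$ are complete multipartite graphs with the given part sizes.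
   Formalization: The critical ideals $I_i^{\mathbb{R}}(G,X_G)$ are taken in the polynomial ring with rational coefficients rather than real coefficients, both for each graph and for each vertex-deleted subgraph. -}

module Defs where

open import Data.Nat as ℕ using (ℕ; zero; suc; _≤_)
open import Data.Fin as Fin using (Fin; zero; suc; punchIn; _<_; #_)
open import Data.Fin.Properties as FinP using ()
open import Data.Vec as Vec using (Vec; replicate; zipWith; updateAt)
open import Data.Vec.Properties as VecP using (≡-dec)
open import Data.Rational as ℚ using (ℚ; 0ℚ; 1ℚ)
open import Data.Integer as ℤ using (+_)
open import Data.List as List using (List; []; _∷_; _++_; map; concatMap; foldr; allFin)
open import Data.Product using (Σ; _×_; _,_; ∃)
open import Data.Bool using (Bool; true; false; if_then_else_)
open import Relation.Nullary using (¬_; Dec; yes; no)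
open import Relation.Nullary.Decidable using (⌊_⌋)
open import Relation.Binary.PropositionalEquality using (_≡_)

-- A polynomial is a finite formal sum of terms (coefficient , exponent
-- vector); two polynomials are equal (≈) iff every monomial has the
-- same total coefficient.

Monomial : ℕ → Set
Monomial n = Vec ℕ n

Poly : ℕ → Set
Poly n = List (ℚ × Monomial n)

coeff : ∀ {n} → Poly n → Monomial n → ℚ
coeff [] m = 0ℚ
coeff ((q , e) ∷ p) m =
  if ⌊ ≡-dec ℕ._≟_ e m ⌋ then q ℚ.+ coeff p m else coeff p m

infix 4 _≈_
_≈_ : ∀ {n} → Poly n → Poly n → Set
p ≈ q = ∀ m → coeff p m ≡ coeff q m

0P : ∀ {n} → Poly n
0P = []

constP : ∀ {n} → ℚ → Poly n
constP c = (c , replicate _ 0) ∷ []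

1P : ∀ {n} → Poly n
1P = constP 1ℚ

varP : ∀ {n} → Fin n → Poly n
varP i = (1ℚ , updateAt (replicate _ 0) i (λ _ → 1)) ∷ []

infixl 6 _+P_
infixl 7 _*P_

_+P_ : ∀ {n} → Poly n → Poly n → Poly n
p +P q = p ++ q

negP : ∀ {n} → Poly n → Poly n
negP = map (λ { (q , e) → (ℚ.- q , e) })

_*P_ : ∀ {n} → Poly n → Poly n → Poly n
p *P q = concatMap (λ { (a , e) → map (λ { (b , f) → (a ℚ.* b , zipWith ℕ._+_ e f) }) q }) p

det : ∀ {n} (k : ℕ) → (Fin k → Fin k → Poly n) → Poly n
det zero M = 1P
det (suc k) M =
  foldr _+P_ 0P
    (map (λ j → sgn j (M zero j *P det k (λ a b → M (suc a) (punchIn j b))))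
         (allFin (suc k)))
  where
  sgn : ∀ {n m} → Fin m → Poly n → Poly n
  sgn zero p = p
  sgn (suc zero) p = negP p
  sgn (suc (suc j)) p = sgn j p

data Combo {n} (S : Poly n → Set) : Poly n → Set where
  nil  : Combo S 0P
  cons : ∀ {p} (c g : Poly n) → S g → Combo S p → Combo S (c *P g +P p)

IsUnitIdeal : ∀ {n} → (Poly n → Set) → Set
IsUnitIdeal S = Σ _ λ p → Combo S p × (p ≈ 1P)

Graph : ℕ → Set
Graph n = Fin n → Fin n → ℕ      -- m_uv = number of edges between u and v

fromEdges : ∀ {n} → List (Fin n × Fin n) → Graph n
fromEdges [] u v = 0
fromEdges ((a , b) ∷ es) u v =
  (if (⌊ a Fin.≟ u ⌋ Data.Bool.∧ ⌊ b Fin.≟ v ⌋) Data.Bool.∨ (⌊ a Fin.≟ v ⌋ Data.Bool.∧ ⌊ b Fin.≟ u ⌋)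
     then 1 else 0) ℕ.+ fromEdges es u v
  where import Data.Bool

deleteVertex : ∀ {k} → Graph (suc k) → Fin (suc k) → Graph k
deleteVertex G v a b = G (punchIn v a) (punchIn v b)

genLaplacian : ∀ {n} → Graph n → Fin n → Fin n → Poly n
genLaplacian G u v with u Fin.≟ v
... | yes _ = varP u
... | no  _ = constP (ℚ.- (+ (G u v) ℚ./ 1))

Increasing : ∀ {i n} → (Fin i → Fin n) → Set
Increasing r = ∀ a b → a < b → r a < r b

IsMinor : ∀ {n} → (Fin n → Fin n → Poly n) → ℕ → Poly n → Set
IsMinor {n} M i p =
  Σ (Fin i → Fin n) λ r → Σ (Fin i → Fin n) λ c →
    Increasing r × Increasing c × (p ≡ det i (λ a b → M (r a) (c b)))

CriticalIdealTrivial : ∀ {n} → Graph n → ℕ → Set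
CriticalIdealTrivial G i = IsUnitIdeal (IsMinor (genLaplacian G) i)

-- γ(G) is the largest i with I_i = ⟨1⟩.
γ≥ : ∀ {n} → Graph n → ℕ → Set
γ≥ G k = Σ ℕ λ i → k ≤ i × CriticalIdealTrivial G i

γ≤ : ∀ {n} → Graph n → ℕ → Set
γ≤ G k = ∀ i → suc k ≤ i → ¬ CriticalIdealTrivial G i

MinimalForbidden : ∀ {k} → Graph (suc k) → Set
MinimalForbidden G = γ≥ G 3 × (∀ v → γ≤ (deleteVertex G v) 2)

-- The graphs (vertex v_i is index i-1).

P4 : Graph 4
P4 = fromEdges ((# 0 , # 1) ∷ (# 1 , # 2) ∷ (# 2 , # 3) ∷ [])

ltimes : Graph 5
ltimes = fromEdges ((# 0 , # 1) ∷ (# 0 , # 2) ∷ (# 1 , # 2) ∷ (# 2 , # 3) ∷ (# 2 , # 4) ∷ [])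

dart : Graph 5
dart = fromEdges ((# 0 , # 1) ∷ (# 0 , # 2) ∷ (# 1 , # 2) ∷ (# 1 , # 3) ∷ (# 2 , # 3) ∷ (# 2 , # 4) ∷ [])

-- K5 minus the path 0-1-2
K5∖P3 : Graph 5
K5∖P3 = fromEdges ((# 0 , # 2) ∷ (# 0 , # 3) ∷ (# 0 , # 4) ∷ (# 1 , # 3) ∷ (# 1 , # 4) ∷ (# 2 , # 3) ∷ (# 2 , # 4) ∷ (# 3 , # 4) ∷ [])

-- complement of P2 ∪ C4 with P2 = 0-1 and C4 = 2-3-4-5-2
coP2∪C4 : Graph 6
coP2∪C4 = fromEdges ((# 0 , # 2) ∷ (# 0 , # 3) ∷ (# 0 , # 4) ∷ (# 0 , # 5) ∷ (# 1 , # 2) ∷ (# 1 , # 3) ∷ (# 1 , # 4) ∷ (# 1 , # 5) ∷ (# 2 , # 4) ∷ (# 3 , # 5) ∷ [])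

-- parts {0,1},{2,3},{4,5}
K222 : Graph 6
K222 = fromEdges ((# 0 , # 2) ∷ (# 0 , # 3) ∷ (# 0 , # 4) ∷ (# 0 , # 5) ∷ (# 1 , # 2) ∷ (# 1 , # 3) ∷ (# 1 , # 4) ∷ (# 1 , # 5) ∷ (# 2 , # 4) ∷ (# 2 , # 5) ∷ (# 3 , # 4) ∷ (# 3 , # 5) ∷ [])

-- parts {0,1},{2,3},{4},{5}
K2211 : Graph 6
K2211 = fromEdges ((# 0 , # 2) ∷ (# 0 , # 3) ∷ (# 0 , # 4) ∷ (# 0 , # 5) ∷ (# 1 , # 2) ∷ (# 1 , # 3) ∷ (# 1 , # 4) ∷ (# 1 , # 5) ∷ (# 2 , # 4) ∷ (# 2 , # 5) ∷ (# 3 , # 4) ∷ (# 3 , # 5) ∷ (# 4 , # 5) ∷ [])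

module Submission where

open import Defs
open import Data.Nat as ℕ using (ℕ; zero; suc; s≤s)
import Data.Nat.Properties as ℕP
open import Data.Fin as Fin using (Fin; zero; suc; toℕ; #_)
import Data.Fin.Properties as FinP
open import Data.Vec using (Vec; []; _∷_; replicate; zipWith; lookup; tabulate)
open import Data.Vec.Properties using (≡-dec; lookup∘tabulate)
open import Data.Integer using (+_)
open import Data.Rational as ℚ using (ℚ; 0ℚ; 1ℚ; ½; -½)
import Data.Rational.Properties as ℚP
open import Data.Rational.Solver using (module +-*-Solver)
open import Algebra.Bundles using (CommutativeRing)
-- This _^_ reduces much faster than that of the semiring bundle, with which it agrees
-- definitionally, so ^-homo-* applies to it.
open import Algebra.Definitions.RawSemiring ℚ.+-*-rawSemiring using (_^_)
open import Algebra.Properties.Semiring.Exp (CommutativeRing.semiring ℚP.+-*-commutativeRing)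
  using (^-homo-*)
open import Data.List as List using (List; []; _∷_; _++_; map; length; filter)
import Data.List.Properties as ListP
open import Data.List.Membership.Propositional using (_∉_)
open import Data.List.Membership.Propositional.Properties using (∈-++⁺ˡ; ∈-++⁺ʳ)
open import Data.List.Relation.Unary.Any using (here; there; any?)
open import Data.Vec.Relation.Unary.Linked using (Linked; []; [-]; _∷_; linked?)
import Data.Vec.Relation.Unary.Linked.Properties as Linked
import Data.List.Relation.Unary.All as All
open import Data.Product using (_×_; _,_; proj₂)
open import Data.Empty using (⊥-elim)
open import Function using (_∘_)
open import Relation.Nullary using (¬_; Dec; yes; no; ¬?)
open import Relation.Nullary.Decidable using (map′; _→-dec_; _×-dec_; True; toWitness)
open import Relation.Binary.PropositionalEquality
open ≡-Reasoning

-- γ(G) ≥ 3 is witnessed by a 3×3 minor of L(G, X) which, multiplied by a rational constant d, equals 1.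
-- γ(G − v) ≤ 2 is witnessed by a rational point at which every minor of L(G − v, X) of size at least 3
-- vanishes: evaluation at that point is a ring homomorphism to ℚ killing the critical ideal, so the
-- ideal cannot contain 1. For each of the seven graphs and each deleted vertex, the witnesses are
-- checked by evaluating the (Laplace-expanded) minors.

support : ∀ {n} → Poly n → List (Monomial n)
support = map proj₂

coeff-∷-≢ : ∀ {n} a {f m : Monomial n} p → f ≢ m → coeff ((a , f) ∷ p) m ≡ coeff p m
coeff-∷-≢ a {f} {m} p f≢m with ≡-dec ℕ._≟_ f m
... | yes f≡m = ⊥-elim (f≢m f≡m)
... | no  _   = refl

coeff-∉support : ∀ {n} {m : Monomial n} (p : Poly n) → m ∉ support p → coeff p m ≡ 0ℚ
coeff-∉support []            m∉ = refl
coeff-∉support ((a , e) ∷ p) m∉ =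
  trans (coeff-∷-≢ a p (λ { refl → m∉ (here refl) })) (coeff-∉support p (m∉ ∘ there))

infix 4 _≈?_
_≈?_ : ∀ {n} (p q : Poly n) → Dec (p ≈ q)
p ≈? q = map′ agreeEverywhere (λ p≈q → All.tabulate (λ {m} _ → p≈q m))
              (All.all? (λ m → coeff p m ℚ.≟ coeff q m) (support p ++ support q))
  where
  agreeEverywhere : All.All (λ m → coeff p m ≡ coeff q m) (support p ++ support q) → p ≈ q
  agreeEverywhere agree m with any? (≡-dec ℕ._≟_ m) (support p ++ support q)
  ... | yes m∈ = All.lookup agree m∈
  ... | no  m∉ = trans (coeff-∉support p (m∉ ∘ ∈-++⁺ˡ))
                       (sym (coeff-∉support q (m∉ ∘ ∈-++⁺ʳ (support p))))

withoutMonomial : ∀ {n} → Monomial n → Poly n → Poly n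
withoutMonomial e = filter (λ t → ¬? (≡-dec ℕ._≟_ (proj₂ t) e))

coeff-withoutMonomial-≡ : ∀ {n} (e : Monomial n) p → coeff (withoutMonomial e p) e ≡ 0ℚ
coeff-withoutMonomial-≡ e []            = refl
coeff-withoutMonomial-≡ e ((a , f) ∷ p) with ≡-dec ℕ._≟_ f e
... | yes _   = coeff-withoutMonomial-≡ e p
... | no  f≢e = trans (coeff-∷-≢ a (withoutMonomial e p) f≢e) (coeff-withoutMonomial-≡ e p)

coeff-withoutMonomial-≢ : ∀ {n} {e m : Monomial n} p → e ≢ m → coeff (withoutMonomial e p) m ≡ coeff p m
coeff-withoutMonomial-≢ []            e≢m = refl
coeff-withoutMonomial-≢ {e = e} {m} ((a , f) ∷ p) e≢m with ≡-dec ℕ._≟_ f e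
... | yes refl = trans (coeff-withoutMonomial-≢ p e≢m) (sym (coeff-∷-≢ a p e≢m))
... | no  _    with ≡-dec ℕ._≟_ f m
...   | yes refl = cong (a ℚ.+_) (coeff-withoutMonomial-≢ p e≢m)
...   | no  _    = coeff-withoutMonomial-≢ p e≢m

withoutMonomial-cong : ∀ {n} (e : Monomial n) p q → p ≈ q → withoutMonomial e p ≈ withoutMonomial e q
withoutMonomial-cong e p q p≈q m with ≡-dec ℕ._≟_ e m
... | yes refl = trans (coeff-withoutMonomial-≡ e p) (sym (coeff-withoutMonomial-≡ e q))
... | no  e≢m  = trans (coeff-withoutMonomial-≢ p e≢m) (trans (p≈q m) (sym (coeff-withoutMonomial-≢ q e≢m)))

withoutMonomial-∷ : ∀ {n} a (e : Monomial n) p → withoutMonomial e ((a , e) ∷ p) ≡ withoutMonomial e p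
withoutMonomial-∷ a e p with ≡-dec ℕ._≟_ e e
... | yes _   = refl
... | no  e≢e = ⊥-elim (e≢e refl)

length-withoutMonomial-∷ : ∀ {n} a (e : Monomial n) p → length (withoutMonomial e ((a , e) ∷ p)) ℕ.≤ length p
length-withoutMonomial-∷ a e p rewrite withoutMonomial-∷ a e p = ListP.length-filter _ p

*P-cons : ∀ {n} a e (p q : Poly n) → ((a , e) ∷ p) *P q ≡ ((a , e) ∷ []) *P q +P p *P q
*P-cons a e p q = cong (_++ p *P q) (sym (ListP.++-identityʳ _))

evalMonomial : ∀ {n} → Vec ℚ n → Monomial n → ℚ
evalMonomial []      []      = 1ℚ
evalMonomial (a ∷ x) (k ∷ e) = a ^ k ℚ.* evalMonomial x e

eval : ∀ {n} → Vec ℚ n → Poly n → ℚ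
eval x []            = 0ℚ
eval x ((a , e) ∷ p) = a ℚ.* evalMonomial x e ℚ.+ eval x p

evalMonomial-zeros : ∀ {n} (x : Vec ℚ n) → evalMonomial x (replicate n 0) ≡ 1ℚ
evalMonomial-zeros []      = refl
evalMonomial-zeros (a ∷ x) = cong (1ℚ ℚ.*_) (evalMonomial-zeros x)

evalMonomial-zipWith-+ : ∀ {n} (x : Vec ℚ n) e f →
  evalMonomial x (zipWith ℕ._+_ e f) ≡ evalMonomial x e ℚ.* evalMonomial x f
evalMonomial-zipWith-+ []      []      []      = refl
evalMonomial-zipWith-+ (a ∷ x) (k ∷ e) (l ∷ f) = begin
  a ^ (k ℕ.+ l) ℚ.* evalMonomial x (zipWith ℕ._+_ e f)
    ≡⟨ cong₂ ℚ._*_ (^-homo-* a k l) (evalMonomial-zipWith-+ x e f) ⟩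
  (a ^ k ℚ.* a ^ l) ℚ.* (evalMonomial x e ℚ.* evalMonomial x f)
    ≡⟨ solve 4 (λ A B C D → (A :* B) :* (C :* D) := (A :* C) :* (B :* D)) refl
         (a ^ k) (a ^ l) (evalMonomial x e) (evalMonomial x f) ⟩
  (a ^ k ℚ.* evalMonomial x e) ℚ.* (a ^ l ℚ.* evalMonomial x f) ∎
  where open +-*-Solver

module _ {n : ℕ} (x : Vec ℚ n) where

  private
    X : Monomial n → ℚ
    X = evalMonomial x

  eval-+P : ∀ (p q : Poly n) → eval x (p +P q) ≡ eval x p ℚ.+ eval x q
  eval-+P []            q = sym (ℚP.+-identityˡ (eval x q))
  eval-+P ((a , e) ∷ p) q = begin
    a ℚ.* X e ℚ.+ eval x (p +P q)     ≡⟨ cong (a ℚ.* X e ℚ.+_) (eval-+P p q) ⟩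
    a ℚ.* X e ℚ.+ (eval x p ℚ.+ eval x q) ≡⟨ sym (ℚP.+-assoc (a ℚ.* X e) (eval x p) (eval x q)) ⟩
    a ℚ.* X e ℚ.+ eval x p ℚ.+ eval x q ∎

  eval-term-*P : ∀ a e (q : Poly n) → eval x (((a , e) ∷ []) *P q) ≡ a ℚ.* X e ℚ.* eval x q
  eval-term-*P a e []            = sym (ℚP.*-zeroʳ (a ℚ.* X e))
  eval-term-*P a e ((b , f) ∷ q) = begin
    a ℚ.* b ℚ.* X (zipWith ℕ._+_ e f) ℚ.+ eval x (((a , e) ∷ []) *P q)
      ≡⟨ cong₂ ℚ._+_ (cong (a ℚ.* b ℚ.*_) (evalMonomial-zipWith-+ x e f)) (eval-term-*P a e q) ⟩
    a ℚ.* b ℚ.* (X e ℚ.* X f) ℚ.+ a ℚ.* X e ℚ.* eval x q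
      ≡⟨ solve 5 (λ A B E F Q → A :* B :* (E :* F) :+ A :* E :* Q := A :* E :* (B :* F :+ Q)) refl
           a b (X e) (X f) (eval x q) ⟩
    a ℚ.* X e ℚ.* (b ℚ.* X f ℚ.+ eval x q) ∎
    where open +-*-Solver

  eval-*P : ∀ (p q : Poly n) → eval x (p *P q) ≡ eval x p ℚ.* eval x q
  eval-*P []            q = sym (ℚP.*-zeroˡ (eval x q))
  eval-*P ((a , e) ∷ p) q = begin
    eval x (((a , e) ∷ p) *P q)                     ≡⟨ cong (eval x) (*P-cons a e p q) ⟩
    eval x (((a , e) ∷ []) *P q +P p *P q)          ≡⟨ eval-+P (((a , e) ∷ []) *P q) (p *P q) ⟩
    eval x (((a , e) ∷ []) *P q) ℚ.+ eval x (p *P q) ≡⟨ cong₂ ℚ._+_ (eval-term-*P a e q) (eval-*P p q) ⟩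
    a ℚ.* X e ℚ.* eval x q ℚ.+ eval x p ℚ.* eval x q ≡⟨ sym (ℚP.*-distribʳ-+ (eval x q) (a ℚ.* X e) (eval x p)) ⟩
    (a ℚ.* X e ℚ.+ eval x p) ℚ.* eval x q ∎

  eval-withoutMonomial : ∀ e (p : Poly n) → eval x p ≡ coeff p e ℚ.* X e ℚ.+ eval x (withoutMonomial e p)
  eval-withoutMonomial e [] = sym (trans (ℚP.+-identityʳ (0ℚ ℚ.* X e)) (ℚP.*-zeroˡ (X e)))
  eval-withoutMonomial e ((a , f) ∷ p) with ≡-dec ℕ._≟_ f e
  ... | yes refl = begin
    a ℚ.* X e ℚ.+ eval x p
      ≡⟨ cong (a ℚ.* X e ℚ.+_) (eval-withoutMonomial e p) ⟩
    a ℚ.* X e ℚ.+ (coeff p e ℚ.* X e ℚ.+ eval x (withoutMonomial e p))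
      ≡⟨ solve 4 (λ A E C R → A :* E :+ (C :* E :+ R) := (A :+ C) :* E :+ R) refl
           a (X e) (coeff p e) (eval x (withoutMonomial e p)) ⟩
    (a ℚ.+ coeff p e) ℚ.* X e ℚ.+ eval x (withoutMonomial e p) ∎
    where open +-*-Solver
  ... | no _ = begin
    a ℚ.* X f ℚ.+ eval x p
      ≡⟨ cong (a ℚ.* X f ℚ.+_) (eval-withoutMonomial e p) ⟩
    a ℚ.* X f ℚ.+ (coeff p e ℚ.* X e ℚ.+ eval x (withoutMonomial e p))
      ≡⟨ solve 3 (λ A C R → A :+ (C :+ R) := C :+ (A :+ R)) refl
           (a ℚ.* X f) (coeff p e ℚ.* X e) (eval x (withoutMonomial e p)) ⟩
    coeff p e ℚ.* X e ℚ.+ (a ℚ.* X f ℚ.+ eval x (withoutMonomial e p)) ∎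
    where open +-*-Solver

  eval-cong-withoutMonomial : ∀ e (p q : Poly n) → p ≈ q →
    eval x (withoutMonomial e p) ≡ eval x (withoutMonomial e q) → eval x p ≡ eval x q
  eval-cong-withoutMonomial e p q p≈q rest = begin
    eval x p                                             ≡⟨ eval-withoutMonomial e p ⟩
    coeff p e ℚ.* X e ℚ.+ eval x (withoutMonomial e p) ≡⟨ cong₂ ℚ._+_ (cong (ℚ._* X e) (p≈q e)) rest ⟩
    coeff q e ℚ.* X e ℚ.+ eval x (withoutMonomial e q) ≡⟨ sym (eval-withoutMonomial e q) ⟩
    eval x q ∎

  private
    eval-cong-bounded : ∀ k (p q : Poly n) → length p ℕ.+ length q ℕ.≤ k → p ≈ q → eval x p ≡ eval x q
    eval-cong-bounded _       []            []            _         _   = refl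
    eval-cong-bounded zero    (_ ∷ _)       _             ()        _
    eval-cong-bounded zero    []            (_ ∷ _)       ()        _
    eval-cong-bounded (suc k) ((a , e) ∷ p) q             (s≤s len) p≈q =
      eval-cong-withoutMonomial e ((a , e) ∷ p) q p≈q
        (eval-cong-bounded k (withoutMonomial e ((a , e) ∷ p)) (withoutMonomial e q) shorter
          (withoutMonomial-cong e ((a , e) ∷ p) q p≈q))
      where
      shorter : length (withoutMonomial e ((a , e) ∷ p)) ℕ.+ length (withoutMonomial e q) ℕ.≤ k
      shorter = ℕP.≤-trans (ℕP.+-mono-≤ (length-withoutMonomial-∷ a e p) (ListP.length-filter _ q)) len
    eval-cong-bounded (suc k) []            ((b , f) ∷ q) (s≤s len) p≈q =
      eval-cong-withoutMonomial f [] ((b , f) ∷ q) p≈q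
        (eval-cong-bounded k [] (withoutMonomial f ((b , f) ∷ q)) shorter
          (withoutMonomial-cong f [] ((b , f) ∷ q) p≈q))
      where
      shorter : length (withoutMonomial f ((b , f) ∷ q)) ℕ.≤ k
      shorter = ℕP.≤-trans (length-withoutMonomial-∷ b f q) len

  eval-cong : ∀ {p q : Poly n} → p ≈ q → eval x p ≡ eval x q
  eval-cong {p} {q} = eval-cong-bounded _ p q ℕP.≤-refl

  eval-1P : eval x 1P ≡ 1ℚ
  eval-1P = trans (ℚP.+-identityʳ _) (trans (ℚP.*-identityˡ _) (evalMonomial-zeros x))

  eval-combo : ∀ {S : Poly n → Set} → (∀ {g} → S g → eval x g ≡ 0ℚ) → ∀ {p} → Combo S p → eval x p ≡ 0ℚ
  eval-combo vanish nil = refl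
  eval-combo vanish (cons {p} c g g∈S combo) = begin
    eval x (c *P g +P p)                ≡⟨ eval-+P (c *P g) p ⟩
    eval x (c *P g) ℚ.+ eval x p        ≡⟨ cong₂ ℚ._+_ (eval-*P c g) (eval-combo vanish combo) ⟩
    eval x c ℚ.* eval x g ℚ.+ 0ℚ       ≡⟨ cong (λ v → eval x c ℚ.* v ℚ.+ 0ℚ) (vanish g∈S) ⟩
    eval x c ℚ.* 0ℚ ℚ.+ 0ℚ             ≡⟨ trans (ℚP.+-identityʳ _) (ℚP.*-zeroʳ (eval x c)) ⟩
    0ℚ ∎

  commonZero⇒¬IsUnitIdeal : ∀ {S : Poly n → Set} → (∀ {g} → S g → eval x g ≡ 0ℚ) → ¬ IsUnitIdeal S
  commonZero⇒¬IsUnitIdeal vanish (p , combo , p≈1) = ℚP.1≢0 (begin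
    1ℚ        ≡⟨ sym eval-1P ⟩
    eval x 1P ≡⟨ sym (eval-cong {p} {1P} p≈1) ⟩
    eval x p  ≡⟨ eval-combo vanish combo ⟩
    0ℚ        ∎)

alternate : ∀ {n m} → Fin m → Poly n → Poly n
alternate zero          p = p
alternate (suc zero)    p = negP p
alternate (suc (suc j)) p = alternate j p

det′ : ∀ {n} k → (Fin k → Fin k → Poly n) → Poly n
det′ zero    M = 1P
det′ (suc k) M = List.foldr _+P_ 0P
  (map (λ j → alternate j (M zero j *P det′ k (λ a b → M (suc a) (Fin.punchIn j b)))) (List.allFin (suc k)))

det′-cong : ∀ {n} k {M M′ : Fin k → Fin k → Poly n} → (∀ a b → M a b ≡ M′ a b) → det′ k M ≡ det′ k M′
det′-cong zero    M≗M′ = refl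
det′-cong (suc k) M≗M′ = cong (List.foldr _+P_ 0P) (ListP.map-cong
  (λ j → cong (alternate j) (cong₂ _*P_ (M≗M′ zero j) (det′-cong k λ a b → M≗M′ (suc a) (Fin.punchIn j b))))
  (List.allFin (suc k)))

det≡det′ : ∀ {n} k → k ℕ.≤ 5 → (M : Fin k → Fin k → Poly n) → det k M ≡ det′ k M
det≡det′ 0 _ M = refl
det≡det′ 1 _ M = refl
det≡det′ 2 _ M = refl
det≡det′ 3 _ M = refl
det≡det′ 4 _ M = refl
det≡det′ 5 _ M = refl
det≡det′ (suc (suc (suc (suc (suc (suc _)))))) (s≤s (s≤s (s≤s (s≤s (s≤s ()))))) M

-- det's sign function is local to a where-block of Defs, so it cannot be named and det-cong cannot be
-- proved by induction on the size. The copy det′ names it, and agrees with det definitionally at each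
-- concrete size; all minors needed here have size at most 5.
det-cong : ∀ {n} k → k ℕ.≤ 5 → {M M′ : Fin k → Fin k → Poly n} → (∀ a b → M a b ≡ M′ a b) → det k M ≡ det k M′
det-cong k k≤5 {M} {M′} M≗M′ = trans (det≡det′ k k≤5 M) (trans (det′-cong k M≗M′) (sym (det≡det′ k k≤5 M′)))

Linked⇒Increasing : ∀ {i n} {v : Vec (Fin n) i} → Linked Fin._<_ v → Increasing (lookup v)
Linked⇒Increasing v↑ a b a<b = Linked.lookup⁺ FinP.<-trans v↑ a<b

Increasing⇒Linked : ∀ {i n} {r : Fin i → Fin n} → Increasing r → Linked Fin._<_ (tabulate r)
Increasing⇒Linked {zero}        r↑ = []
Increasing⇒Linked {suc zero}    r↑ = [-]
Increasing⇒Linked {suc (suc i)} r↑ =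
  r↑ zero (suc zero) ℕ.z<s ∷ Increasing⇒Linked (λ a b a<b → r↑ (suc a) (suc b) (ℕ.s<s a<b))

all-Vec? : ∀ {k i} {P : Vec (Fin k) i → Set} → (∀ v → Dec (P v)) → Dec (∀ v → P v)
all-Vec? {i = zero}  P? = map′ (λ { p [] → p }) (λ p → p []) (P? [])
all-Vec? {i = suc i} P? = map′ (λ { p (a ∷ v) → p a v }) (λ p a v → p (a ∷ v))
                               (FinP.all? λ a → all-Vec? λ v → P? (a ∷ v))

MinorsVanishAt : ∀ {n} → Vec ℚ n → (Fin n → Fin n → Poly n) → ℕ → Set
MinorsVanishAt x M i = ∀ {g} → IsMinor M i g → eval x g ≡ 0ℚ

minorsVanishAt-aboveSize : ∀ {n i} (x : Vec ℚ n) M → n ℕ.< i → MinorsVanishAt x M i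
minorsVanishAt-aboveSize x M n<i (r , _ , r↑ , _) with FinP.pigeonhole n<i r
... | a , b , a<b , ra≡rb = ⊥-elim (FinP.<-irrefl ra≡rb (r↑ a b a<b))

minorsVanishAt? : ∀ {n} (x : Vec ℚ n) M i → n ℕ.≤ 5 → Dec (MinorsVanishAt x M i)
minorsVanishAt? {n} x M i n≤5 with i ℕ.≤? n
... | no  i≰n = yes (minorsVanishAt-aboveSize x M (ℕP.≰⇒> i≰n))
... | yes i≤n = map′ fromIndexVectors toIndexVectors
  (all-Vec? λ v → linked? Fin._<?_ v →-dec all-Vec? λ w → linked? Fin._<?_ w →-dec eval x (minorAt v w) ℚ.≟ 0ℚ)
  where
  minorAt : Vec (Fin n) i → Vec (Fin n) i → Poly n
  minorAt v w = det i (λ a b → M (lookup v a) (lookup w b))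

  VanishAtIndexVectors : Set
  VanishAtIndexVectors = ∀ v → Linked Fin._<_ v → ∀ w → Linked Fin._<_ w → eval x (minorAt v w) ≡ 0ℚ

  toIndexVectors : MinorsVanishAt x M i → VanishAtIndexVectors
  toIndexVectors vanish v v↑ w w↑ = vanish (lookup v , lookup w , Linked⇒Increasing v↑ , Linked⇒Increasing w↑ , refl)

  fromIndexVectors : VanishAtIndexVectors → MinorsVanishAt x M i
  fromIndexVectors vanish (r , c , r↑ , c↑ , refl) = begin
    eval x (det i (λ a b → M (r a) (c b)))
      ≡⟨ cong (eval x) (det-cong i (ℕP.≤-trans i≤n n≤5) λ a b →
           cong₂ M (sym (lookup∘tabulate r a)) (sym (lookup∘tabulate c b))) ⟩
    eval x (minorAt (tabulate r) (tabulate c))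
      ≡⟨ vanish (tabulate r) (Increasing⇒Linked r↑) (tabulate c) (Increasing⇒Linked c↑) ⟩
    0ℚ ∎

HigherMinorsVanishAt : ∀ {n} → ℕ → Vec ℚ n → (Fin n → Fin n → Poly n) → Set
HigherMinorsVanishAt m x M = ∀ i → m ℕ.< i → MinorsVanishAt x M i

higherMinorsVanishAt? : ∀ {n} m (x : Vec ℚ n) M → n ℕ.≤ 5 → Dec (HigherMinorsVanishAt m x M)
higherMinorsVanishAt? {n} m x M n≤5 = map′ fromBounded (λ vanish i → vanish (toℕ i))
  (FinP.all? λ i → m ℕ.<? toℕ i →-dec minorsVanishAt? x M (toℕ i) n≤5)
  where
  fromBounded : (∀ (i : Fin (suc n)) → m ℕ.< toℕ i → MinorsVanishAt x M (toℕ i)) → HigherMinorsVanishAt m x M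
  fromBounded vanish i m<i with i ℕ.≤? n
  ... | no  i≰n = minorsVanishAt-aboveSize x M (ℕP.≰⇒> i≰n)
  ... | yes i≤n = subst (MinorsVanishAt x M) (FinP.toℕ-fromℕ< (s≤s i≤n))
    (vanish (Fin.fromℕ< (s≤s i≤n)) (subst (m ℕ.<_) (sym (FinP.toℕ-fromℕ< (s≤s i≤n))) m<i))

UnitMinor : ∀ {n i} → Graph n → Vec (Fin n) i → Vec (Fin n) i → ℚ → Set
UnitMinor {i = i} G rows cols d = Linked Fin._<_ rows × Linked Fin._<_ cols ×
  (constP d *P det i (λ a b → genLaplacian G (lookup rows a) (lookup cols b)) ≈ 1P)

unitMinor? : ∀ {n i} (G : Graph n) rows cols d → Dec (UnitMinor {n} {i} G rows cols d)
unitMinor? {i = i} G rows cols d = linked? Fin._<?_ rows ×-dec linked? Fin._<?_ cols ×-dec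
  (constP d *P det i (λ a b → genLaplacian G (lookup rows a) (lookup cols b)) ≈? 1P)

unitMinor⇒γ≥ : ∀ {n i} (G : Graph n) rows cols d → UnitMinor {n} {i} G rows cols d → γ≥ G i
unitMinor⇒γ≥ {i = i} G rows cols d (rows↑ , cols↑ , d·minor≈1) =
  i , ℕP.≤-refl , constP d *P minor +P 0P ,
  cons (constP d) minor (lookup rows , lookup cols , Linked⇒Increasing rows↑ , Linked⇒Increasing cols↑ , refl) nil ,
  subst (_≈ 1P) (sym (ListP.++-identityʳ (constP d *P minor))) d·minor≈1
  where
  minor : Poly _
  minor = det i (λ a b → genLaplacian G (lookup rows a) (lookup cols b))

commonZero⇒γ≤ : ∀ {n} (G : Graph n) (x : Vec ℚ n) m → HigherMinorsVanishAt m x (genLaplacian G) → γ≤ G m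
commonZero⇒γ≤ G x m vanish i m<i = commonZero⇒¬IsUnitIdeal x (vanish i m<i)

minimalForbidden-byDecision :
  ∀ {k} (G : Graph (suc k)) (rows cols : Vec (Fin (suc k)) 3) (d : ℚ) (zeros : Vec (Vec ℚ k) (suc k))
  {k≤5 : True (k ℕ.≤? 5)}
  {unit : True (unitMinor? G rows cols d)}
  {vanish : True (FinP.all? λ v →
     higherMinorsVanishAt? 2 (lookup zeros v) (genLaplacian (deleteVertex G v)) (toWitness k≤5))} →
  MinimalForbidden G
minimalForbidden-byDecision G rows cols d zeros {unit = unit} {vanish} =
  unitMinor⇒γ≥ G rows cols d (toWitness unit) ,
  λ v → commonZero⇒γ≤ (deleteVertex G v) (lookup zeros v) 2 (toWitness vanish v)

-1ℚ -2ℚ : ℚ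
-1ℚ = ℚ.- 1ℚ
-2ℚ = ℚ.- (+ 2 ℚ./ 1)

-- Row v of the last argument is a point in coordinates indexed by the vertices of G − v, that is,
-- the vertices of G other than v in increasing order.
P4-minimalForbidden : MinimalForbidden P4
P4-minimalForbidden = minimalForbidden-byDecision P4 (# 0 ∷ # 1 ∷ # 2 ∷ []) (# 1 ∷ # 2 ∷ # 3 ∷ []) -1ℚ
  (replicate 4 (replicate 3 0ℚ))

ltimes-minimalForbidden : MinimalForbidden ltimes
ltimes-minimalForbidden = minimalForbidden-byDecision ltimes (# 0 ∷ # 2 ∷ # 3 ∷ []) (# 1 ∷ # 2 ∷ # 4 ∷ []) 1ℚ
  ( (0ℚ  ∷ 0ℚ  ∷ 0ℚ ∷ 0ℚ ∷ [])
  ∷ (0ℚ  ∷ 0ℚ  ∷ 0ℚ ∷ 0ℚ ∷ [])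
  ∷ (0ℚ  ∷ 0ℚ  ∷ 0ℚ ∷ 0ℚ ∷ [])
  ∷ (-1ℚ ∷ -1ℚ ∷ 0ℚ ∷ 1ℚ ∷ [])
  ∷ (-1ℚ ∷ -1ℚ ∷ 0ℚ ∷ 1ℚ ∷ [])
  ∷ [])

dart-minimalForbidden : MinimalForbidden dart
dart-minimalForbidden = minimalForbidden-byDecision dart (# 0 ∷ # 1 ∷ # 2 ∷ []) (# 1 ∷ # 3 ∷ # 4 ∷ []) -1ℚ
  ( (-1ℚ ∷ 0ℚ  ∷ -1ℚ ∷ 1ℚ ∷ [])
  ∷ (0ℚ  ∷ 0ℚ  ∷ 0ℚ  ∷ 0ℚ ∷ [])
  ∷ (0ℚ  ∷ 0ℚ  ∷ 0ℚ  ∷ 0ℚ ∷ [])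
  ∷ (-1ℚ ∷ -1ℚ ∷ 0ℚ  ∷ 1ℚ ∷ [])
  ∷ (0ℚ  ∷ 0ℚ  ∷ -2ℚ ∷ 0ℚ ∷ [])
  ∷ [])

K5∖P3-minimalForbidden : MinimalForbidden K5∖P3
K5∖P3-minimalForbidden = minimalForbidden-byDecision K5∖P3 (# 0 ∷ # 1 ∷ # 3 ∷ []) (# 1 ∷ # 2 ∷ # 4 ∷ []) -1ℚ
  ( (0ℚ  ∷ 0ℚ  ∷ 0ℚ  ∷ -2ℚ ∷ [])
  ∷ (0ℚ  ∷ -1ℚ ∷ -1ℚ ∷ -1ℚ ∷ [])
  ∷ (0ℚ  ∷ 0ℚ  ∷ 0ℚ  ∷ -2ℚ ∷ [])
  ∷ (-1ℚ ∷ -1ℚ ∷ -1ℚ ∷ -2ℚ ∷ [])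
  ∷ (-1ℚ ∷ -1ℚ ∷ -1ℚ ∷ -2ℚ ∷ [])
  ∷ [])

coP2∪C4-minimalForbidden : MinimalForbidden coP2∪C4
coP2∪C4-minimalForbidden = minimalForbidden-byDecision coP2∪C4 (# 0 ∷ # 2 ∷ # 3 ∷ []) (# 1 ∷ # 4 ∷ # 5 ∷ []) ½
  ( (-2ℚ ∷ -1ℚ ∷ -1ℚ ∷ -1ℚ ∷ -1ℚ ∷ [])
  ∷ (-2ℚ ∷ -1ℚ ∷ -1ℚ ∷ -1ℚ ∷ -1ℚ ∷ [])
  ∷ (0ℚ  ∷ 0ℚ  ∷ -1ℚ ∷ 1ℚ  ∷ -1ℚ ∷ [])
  ∷ (0ℚ  ∷ 0ℚ  ∷ -1ℚ ∷ -1ℚ ∷ 1ℚ  ∷ [])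
  ∷ (0ℚ  ∷ 0ℚ  ∷ 1ℚ  ∷ -1ℚ ∷ -1ℚ ∷ [])
  ∷ (0ℚ  ∷ 0ℚ  ∷ -1ℚ ∷ 1ℚ  ∷ -1ℚ ∷ [])
  ∷ [])

K222-minimalForbidden : MinimalForbidden K222
K222-minimalForbidden = minimalForbidden-byDecision K222 (# 0 ∷ # 2 ∷ # 4 ∷ []) (# 1 ∷ # 3 ∷ # 5 ∷ []) -½
  ( (-2ℚ ∷ 0ℚ ∷ 0ℚ  ∷ 0ℚ ∷ 0ℚ  ∷ [])
  ∷ (-2ℚ ∷ 0ℚ ∷ 0ℚ  ∷ 0ℚ ∷ 0ℚ  ∷ [])
  ∷ (0ℚ  ∷ 0ℚ ∷ -2ℚ ∷ 0ℚ ∷ 0ℚ  ∷ [])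
  ∷ (0ℚ  ∷ 0ℚ ∷ -2ℚ ∷ 0ℚ ∷ 0ℚ  ∷ [])
  ∷ (0ℚ  ∷ 0ℚ ∷ 0ℚ  ∷ 0ℚ ∷ -2ℚ ∷ [])
  ∷ (0ℚ  ∷ 0ℚ ∷ 0ℚ  ∷ 0ℚ ∷ -2ℚ ∷ [])
  ∷ [])

K2211-minimalForbidden : MinimalForbidden K2211
K2211-minimalForbidden = minimalForbidden-byDecision K2211 (# 0 ∷ # 2 ∷ # 4 ∷ []) (# 1 ∷ # 3 ∷ # 5 ∷ []) -1ℚ
  ( (-1ℚ ∷ 0ℚ ∷ 0ℚ  ∷ -1ℚ ∷ -1ℚ ∷ [])
  ∷ (-1ℚ ∷ 0ℚ ∷ 0ℚ  ∷ -1ℚ ∷ -1ℚ ∷ [])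
  ∷ (0ℚ  ∷ 0ℚ ∷ -1ℚ ∷ -1ℚ ∷ -1ℚ ∷ [])
  ∷ (0ℚ  ∷ 0ℚ ∷ -1ℚ ∷ -1ℚ ∷ -1ℚ ∷ [])
  ∷ (0ℚ  ∷ 0ℚ ∷ 0ℚ  ∷ 0ℚ  ∷ -2ℚ ∷ [])
  ∷ (0ℚ  ∷ 0ℚ ∷ 0ℚ  ∷ 0ℚ  ∷ -2ℚ ∷ [])
  ∷ [])

mainTheorem3 : MinimalForbidden P4 × MinimalForbidden ltimes × MinimalForbidden dart × MinimalForbidden K5∖P3 × MinimalForbidden coP2∪C4 × MinimalForbidden K222 × MinimalForbidden K2211
mainTheorem3 =
  P4-minimalForbidden , ltimes-minimalForbidden , dart-minimalForbidden , K5∖P3-minimalForbidden ,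
  coP2∪C4-minimalForbidden , K222-minimalForbidden , K2211-minimalForbidden
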